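{- Let $n$ be a prime number and let $a_1,a_2,\ldots,a_n$ be any integers. Then the number $$\sum_{k=1}^{n-1}\frac{1}{k}\sum_{\substack{\lambda_1+\lambda_2+\cdots+\lambda_k=n\\ \lambda_i>0}} a_{\lambda_1}a_{\lambda_2}\cdots a_{\lambda_k}$$ is an integer, where the inner sum runs over all ordered $k$-tuples $(\lambda_1,\ldots,\lambda_k)$ of positive integers with $\lambda_1+\cdots+\lambda_k=n$. -}

module Defs where

open import Data.Nat as ℕ using (ℕ; zero; suc; _∸_)
open import Data.Integer as ℤ using (ℤ)
open import Data.List using (List; []; _∷_; map; concatMap; upTo; sum; product; foldr)
open import Data.Rational as ℚ using (ℚ)

-- compositions n k : all ordered k-tuples (λ₁,…,λₖ) of positive naturals
-- with λ₁ + ⋯ + λₖ = n, each given as a list of length k.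
compositions : ℕ → ℕ → List (List ℕ)
compositions zero    zero    = [] ∷ []
compositions (suc _) zero    = []
compositions n       (suc k) =
  concatMap (λ i → map (suc i ∷_) (compositions (n ∸ suc i) k)) (upTo n)

innerSum : (ℕ → ℤ) → ℕ → ℕ → ℤ
innerSum a n k = foldr ℤ._+_ (ℤ.+ 0) (map (λ c → foldr ℤ._*_ (ℤ.+ 1) (map a c)) (compositions n k))

corollarySum : (ℕ → ℤ) → ℕ → ℚ
corollarySum a n = foldr ℚ._+_ ℚ.0ℚ (map (λ j → innerSum a n (suc j) ℚ./ suc j) (upTo (n ∸ 1)))

-- Summing λ₁ + ⋯ + λₖ = n over all compositions gives n · S(n,k), where S(n,k) is
-- the inner sum; by symmetry each of the k parts contributes the same amount, so
-- n · S(n,k) = k · W(n,k) with W(n,k) the sum of λ₁ a_{λ₁}⋯a_{λₖ}.  Hence k divides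
-- n · S(n,k), and for prime n and 0 < k < n it divides S(n,k): every term
-- S(n,k)/k is an integer.
module Submission where

open import Defs
open import Data.Nat using (ℕ)
open import Data.Nat.Primality using (Prime)
open import Data.Integer using (ℤ)
open import Data.Rational using (ℚ; _/_)
open import Data.Product using (∃)
open import Relation.Binary.PropositionalEquality using (_≡_)

open import Data.Nat as ℕ using (zero; suc; _∸_; _<_; s≤s)
import Data.Nat.Properties as ℕ
open import Data.Nat.Coprimality using (prime⇒coprime) renaming (sym to coprime-sym)
open import Data.Integer as ℤ using (+_; _+_; _*_)
import Data.Integer.Properties as ℤ
open import Data.Integer.Coprimality using (coprime-divisor)
open import Data.Integer.Divisibility.Signed using (_∣_; divides; ∣ᵤ⇒∣; ∣⇒∣ᵤ)
open import Data.Integer.Tactic.RingSolver using (solve-∀)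
open import Data.List using (List; []; _∷_; _++_; map; concatMap; upTo; applyUpTo; foldr)
open import Data.List.Properties using (map-∘; map-concatMap; map-applyUpTo)
open import Data.List.Relation.Unary.All using (All; []; _∷_)
open import Data.List.Relation.Unary.All.Properties using (applyUpTo⁺₁)
import Data.Rational as ℚ
import Data.Rational.Properties as ℚ
open import Data.Rational.Unnormalised using (mkℚᵘ; *≡*)
import Data.Rational.Unnormalised.Properties as ℚᵘ
open import Data.Product using (_,_)
open import Relation.Binary.PropositionalEquality using (refl; sym; trans; cong; cong₂; module ≡-Reasoning)
open ≡-Reasoning

sumℤ : List ℤ → ℤ
sumℤ = foldr _+_ (+ 0)

sumℤ-++ : ∀ xs ys → sumℤ (xs ++ ys) ≡ sumℤ xs + sumℤ ys
sumℤ-++ []       ys = sym (ℤ.+-identityˡ _)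
sumℤ-++ (x ∷ xs) ys = trans (cong (_+_ x) (sumℤ-++ xs ys)) (sym (ℤ.+-assoc x _ _))

sumℤ-concatMap : ∀ {A : Set} (f : A → List ℤ) xs →
                 sumℤ (concatMap f xs) ≡ sumℤ (map (λ x → sumℤ (f x)) xs)
sumℤ-concatMap f []       = refl
sumℤ-concatMap f (x ∷ xs) =
  trans (sumℤ-++ (f x) (concatMap f xs)) (cong (_+_ (sumℤ (f x))) (sumℤ-concatMap f xs))

*-distribˡ-sumℤ : ∀ c xs → c * sumℤ xs ≡ sumℤ (map (c *_) xs)
*-distribˡ-sumℤ c []       = ℤ.*-zeroʳ c
*-distribˡ-sumℤ c (x ∷ xs) = trans (ℤ.*-distribˡ-+ c x _) (cong (_+_ (c * x)) (*-distribˡ-sumℤ c xs))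

∑ : ℕ → (ℕ → ℤ) → ℤ
∑ n f = sumℤ (applyUpTo f n)

∑-cong : ∀ n {f g : ℕ → ℤ} → (∀ {i} → i < n → f i ≡ g i) → ∑ n f ≡ ∑ n g
∑-cong zero    f≗g = refl
∑-cong (suc n) f≗g = cong₂ _+_ (f≗g (s≤s ℕ.z≤n)) (∑-cong n (λ i<n → f≗g (s≤s i<n)))

∑-zero : ∀ n → ∑ n (λ _ → + 0) ≡ + 0
∑-zero zero    = refl
∑-zero (suc n) = trans (ℤ.+-identityˡ _) (∑-zero n)

∑-distrib-+ : ∀ n (f g : ℕ → ℤ) → ∑ n (λ i → f i + g i) ≡ ∑ n f + ∑ n g
∑-distrib-+ zero    f g = refl
∑-distrib-+ (suc n) f g = begin
  f 0 + g 0 + ∑ n (λ i → f (suc i) + g (suc i))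
    ≡⟨ cong (_+_ (f 0 + g 0)) (∑-distrib-+ n (λ i → f (suc i)) (λ i → g (suc i))) ⟩
  f 0 + g 0 + (∑ n (λ i → f (suc i)) + ∑ n (λ i → g (suc i)))
    ≡⟨ interchange (f 0) (g 0) _ _ ⟩
  f 0 + ∑ n (λ i → f (suc i)) + (g 0 + ∑ n (λ i → g (suc i)))
    ∎
  where
  interchange : ∀ x y u v → x + y + (u + v) ≡ x + u + (y + v)
  interchange = solve-∀

*-distribˡ-∑ : ∀ n c (f : ℕ → ℤ) → c * ∑ n f ≡ ∑ n (λ i → c * f i)
*-distribˡ-∑ n c f = trans (*-distribˡ-sumℤ c (applyUpTo f n)) (cong sumℤ (map-applyUpTo f (c *_) n))

sumℤ-map-upTo : ∀ n (f : ℕ → ℤ) → sumℤ (map f (upTo n)) ≡ ∑ n f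
sumℤ-map-upTo n f = cong sumℤ (map-applyUpTo (λ i → i) f n)

∑-triangle-comm : ∀ n (g : ℕ → ℕ → ℤ) →
  ∑ n (λ i → ∑ (n ∸ suc i) (λ j → g i j)) ≡ ∑ n (λ j → ∑ (n ∸ suc j) (λ i → g i j))
∑-triangle-comm zero          g = refl
∑-triangle-comm (suc zero)    g = refl
∑-triangle-comm (suc (suc m)) g = begin
  (g 0 0 + row) + ∑ (suc m) (λ i → ∑ (m ∸ i) (λ j → g (suc i) j))
    ≡⟨ cong (_+_ (g 0 0 + row)) (∑-triangle-comm (suc m) (λ i j → g (suc i) j)) ⟩
  (g 0 0 + row) + (column + ∑ m (λ j → ∑ (m ∸ suc j) (λ i → g (suc i) (suc j))))
    ≡⟨ cong (λ t → g 0 0 + row + (column + t)) (sym (∑-triangle-comm m (λ i j → g (suc i) (suc j)))) ⟩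
  (g 0 0 + row) + (column + ∑ m (λ i → ∑ (m ∸ suc i) (λ j → g (suc i) (suc j))))
    ≡⟨ interchange (g 0 0) row column _ ⟩
  (g 0 0 + column) + (row + ∑ m (λ i → ∑ (m ∸ suc i) (λ j → g (suc i) (suc j))))
    ≡⟨ cong (_+_ (g 0 0 + column)) (∑-triangle-comm (suc m) (λ i j → g i (suc j))) ⟩
  (g 0 0 + column) + ∑ (suc m) (λ j → ∑ (m ∸ j) (λ i → g i (suc j)))
    ∎
  where
  row    = ∑ m (λ j → g 0 (suc j))
  column = ∑ m (λ i → g (suc i) 0)
  interchange : ∀ x r c t → (x + r) + (c + t) ≡ (x + c) + (r + t)
  interchange = solve-∀

module _ (a : ℕ → ℤ) where

  monomial : List ℕ → ℤ
  monomial c = foldr _*_ (+ 1) (map a c)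

  sumℤ-monomial-prepend : ∀ x cs →
    sumℤ (map monomial (map (x ∷_) cs)) ≡ a x * sumℤ (map monomial cs)
  sumℤ-monomial-prepend x cs = begin
    sumℤ (map monomial (map (x ∷_) cs))   ≡⟨ cong sumℤ (sym (map-∘ cs)) ⟩
    sumℤ (map (λ c → a x * monomial c) cs) ≡⟨ cong sumℤ (map-∘ cs) ⟩
    sumℤ (map (a x *_) (map monomial cs))  ≡⟨ sym (*-distribˡ-sumℤ (a x) (map monomial cs)) ⟩
    a x * sumℤ (map monomial cs)           ∎

  compositions-suc : ∀ n k → compositions n (suc k) ≡
    concatMap (λ i → map (suc i ∷_) (compositions (n ∸ suc i) k)) (upTo n)
  compositions-suc zero    k = refl
  compositions-suc (suc n) k = refl

  innerSum-suc : ∀ n k → innerSum a n (suc k) ≡ ∑ n (λ i → a (suc i) * innerSum a (n ∸ suc i) k)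
  innerSum-suc n k = begin
    sumℤ (map monomial (compositions n (suc k)))
      ≡⟨ cong (λ cs → sumℤ (map monomial cs)) (compositions-suc n k) ⟩
    sumℤ (map monomial (concatMap prepended (upTo n)))
      ≡⟨ cong sumℤ (map-concatMap monomial prepended (upTo n)) ⟩
    sumℤ (concatMap (λ i → map monomial (prepended i)) (upTo n))
      ≡⟨ sumℤ-concatMap (λ i → map monomial (prepended i)) (upTo n) ⟩
    sumℤ (map (λ i → sumℤ (map monomial (prepended i))) (upTo n))
      ≡⟨ sumℤ-map-upTo n _ ⟩
    ∑ n (λ i → sumℤ (map monomial (prepended i)))
      ≡⟨ ∑-cong n (λ {i} _ → sumℤ-monomial-prepend (suc i) (compositions (n ∸ suc i) k)) ⟩
    ∑ n (λ i → a (suc i) * innerSum a (n ∸ suc i) k)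
      ∎
    where
    prepended : ℕ → List (List ℕ)
    prepended i = map (suc i ∷_) (compositions (n ∸ suc i) k)

  -- the sum of λ₁ a_{λ₁}⋯a_{λ_{k+1}} over the compositions of n into k + 1 parts
  firstPartWeighted : ℕ → ℕ → ℤ
  firstPartWeighted n k = ∑ n (λ i → + suc i * (a (suc i) * innerSum a (n ∸ suc i) k))

  *-innerSum-zero : ∀ m → + m * innerSum a m 0 ≡ + 0
  *-innerSum-zero zero    = refl
  *-innerSum-zero (suc m) = ℤ.*-zeroʳ (+ suc m)

  -- Splits n = λ₁ + (n − λ₁) inside the recursion for innerSum.
  *-innerSum-suc : ∀ n k → + n * innerSum a n (suc k) ≡
    firstPartWeighted n k + ∑ n (λ i → a (suc i) * (+ (n ∸ suc i) * innerSum a (n ∸ suc i) k))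
  *-innerSum-suc n k = begin
    + n * innerSum a n (suc k)
      ≡⟨ cong (+ n *_) (innerSum-suc n k) ⟩
    + n * ∑ n (λ i → a (suc i) * innerSum a (n ∸ suc i) k)
      ≡⟨ *-distribˡ-∑ n (+ n) _ ⟩
    ∑ n (λ i → + n * (a (suc i) * innerSum a (n ∸ suc i) k))
      ≡⟨ ∑-cong n split ⟩
    ∑ n (λ i → + suc i * (a (suc i) * innerSum a (n ∸ suc i) k)
             + a (suc i) * (+ (n ∸ suc i) * innerSum a (n ∸ suc i) k))
      ≡⟨ ∑-distrib-+ n _ _ ⟩
    firstPartWeighted n k + ∑ n (λ i → a (suc i) * (+ (n ∸ suc i) * innerSum a (n ∸ suc i) k))
      ∎
    where
    distrib : ∀ x y u v → (x + y) * (u * v) ≡ x * (u * v) + u * (y * v)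
    distrib = solve-∀
    split : ∀ {i} → i < n → + n * (a (suc i) * innerSum a (n ∸ suc i) k) ≡
      + suc i * (a (suc i) * innerSum a (n ∸ suc i) k) + a (suc i) * (+ (n ∸ suc i) * innerSum a (n ∸ suc i) k)
    split {i} i<n = begin
      + n * (a (suc i) * innerSum a (n ∸ suc i) k)
        ≡⟨ cong (λ m → + m * (a (suc i) * innerSum a (n ∸ suc i) k)) (sym (ℕ.m+[n∸m]≡n i<n)) ⟩
      + (suc i ℕ.+ (n ∸ suc i)) * (a (suc i) * innerSum a (n ∸ suc i) k)
        ≡⟨ cong (_* (a (suc i) * innerSum a (n ∸ suc i) k)) (ℤ.pos-+ (suc i) (n ∸ suc i)) ⟩
      (+ suc i + + (n ∸ suc i)) * (a (suc i) * innerSum a (n ∸ suc i) k)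
        ≡⟨ distrib (+ suc i) (+ (n ∸ suc i)) (a (suc i)) (innerSum a (n ∸ suc i) k) ⟩
      + suc i * (a (suc i) * innerSum a (n ∸ suc i) k) + a (suc i) * (+ (n ∸ suc i) * innerSum a (n ∸ suc i) k)
        ∎

  ∑-prepend-firstPartWeighted : ∀ n k →
    ∑ n (λ i → a (suc i) * firstPartWeighted (n ∸ suc i) k) ≡ firstPartWeighted n (suc k)
  ∑-prepend-firstPartWeighted n k = begin
    ∑ n (λ i → a (suc i) * firstPartWeighted (n ∸ suc i) k)
      ≡⟨ ∑-cong n (λ {i} _ → *-distribˡ-∑ (n ∸ suc i) (a (suc i)) _) ⟩
    ∑ n (λ i → ∑ (n ∸ suc i) (λ j → a (suc i) * (+ suc j * (a (suc j) * innerSum a (n ∸ suc i ∸ suc j) k))))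
      ≡⟨ ∑-triangle-comm n _ ⟩
    ∑ n (λ j → ∑ (n ∸ suc j) (λ i → a (suc i) * (+ suc j * (a (suc j) * innerSum a (n ∸ suc i ∸ suc j) k))))
      ≡⟨ ∑-cong n (λ {j} _ → ∑-cong (n ∸ suc j) (λ {i} _ → reorder i j)) ⟩
    ∑ n (λ j → ∑ (n ∸ suc j) (λ i → + suc j * (a (suc j) * (a (suc i) * innerSum a (n ∸ suc j ∸ suc i) k))))
      ≡⟨ ∑-cong n (λ {j} _ → sym (factor j)) ⟩
    firstPartWeighted n (suc k)
      ∎
    where
    rearrange : ∀ u x v s → u * (x * (v * s)) ≡ x * (v * (u * s))
    rearrange = solve-∀
    ∸-swap : ∀ i j → n ∸ suc i ∸ suc j ≡ n ∸ suc j ∸ suc i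
    ∸-swap i j = begin
      n ∸ suc i ∸ suc j      ≡⟨ ℕ.∸-+-assoc n (suc i) (suc j) ⟩
      n ∸ (suc i ℕ.+ suc j)  ≡⟨ cong (n ∸_) (ℕ.+-comm (suc i) (suc j)) ⟩
      n ∸ (suc j ℕ.+ suc i)  ≡⟨ ℕ.∸-+-assoc n (suc j) (suc i) ⟨
      n ∸ suc j ∸ suc i      ∎
    reorder : ∀ i j → a (suc i) * (+ suc j * (a (suc j) * innerSum a (n ∸ suc i ∸ suc j) k)) ≡
                      + suc j * (a (suc j) * (a (suc i) * innerSum a (n ∸ suc j ∸ suc i) k))
    reorder i j = trans (cong (λ m → a (suc i) * (+ suc j * (a (suc j) * innerSum a m k))) (∸-swap i j))
                        (rearrange (a (suc i)) (+ suc j) (a (suc j)) _)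
    factor : ∀ j → + suc j * (a (suc j) * innerSum a (n ∸ suc j) (suc k)) ≡
      ∑ (n ∸ suc j) (λ i → + suc j * (a (suc j) * (a (suc i) * innerSum a (n ∸ suc j ∸ suc i) k)))
    factor j = begin
      + suc j * (a (suc j) * innerSum a (n ∸ suc j) (suc k))
        ≡⟨ cong (λ t → + suc j * (a (suc j) * t)) (innerSum-suc (n ∸ suc j) k) ⟩
      + suc j * (a (suc j) * ∑ (n ∸ suc j) (λ i → a (suc i) * innerSum a (n ∸ suc j ∸ suc i) k))
        ≡⟨ cong (+ suc j *_) (*-distribˡ-∑ (n ∸ suc j) (a (suc j)) _) ⟩
      + suc j * ∑ (n ∸ suc j) (λ i → a (suc j) * (a (suc i) * innerSum a (n ∸ suc j ∸ suc i) k))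
        ≡⟨ *-distribˡ-∑ (n ∸ suc j) (+ suc j) _ ⟩
      ∑ (n ∸ suc j) (λ i → + suc j * (a (suc j) * (a (suc i) * innerSum a (n ∸ suc j ∸ suc i) k)))
        ∎

  n*innerSum≡k*firstPartWeighted : ∀ k n → + n * innerSum a n (suc k) ≡ + suc k * firstPartWeighted n k
  n*innerSum≡k*firstPartWeighted zero n = begin
    + n * innerSum a n 1
      ≡⟨ *-innerSum-suc n 0 ⟩
    firstPartWeighted n 0 + ∑ n (λ i → a (suc i) * (+ (n ∸ suc i) * innerSum a (n ∸ suc i) 0))
      ≡⟨ cong (_+_ (firstPartWeighted n 0)) (trans (∑-cong n vanish) (∑-zero n)) ⟩
    firstPartWeighted n 0 + + 0
      ≡⟨ ℤ.+-identityʳ _ ⟩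
    firstPartWeighted n 0
      ≡⟨ ℤ.*-identityˡ _ ⟨
    + 1 * firstPartWeighted n 0
      ∎
    where
    vanish : ∀ {i} → i < n → a (suc i) * (+ (n ∸ suc i) * innerSum a (n ∸ suc i) 0) ≡ + 0
    vanish {i} _ = trans (cong (a (suc i) *_) (*-innerSum-zero (n ∸ suc i))) (ℤ.*-zeroʳ (a (suc i)))
  n*innerSum≡k*firstPartWeighted (suc k) n = begin
    + n * innerSum a n (suc (suc k))
      ≡⟨ *-innerSum-suc n (suc k) ⟩
    W + ∑ n (λ i → a (suc i) * (+ (n ∸ suc i) * innerSum a (n ∸ suc i) (suc k)))
      ≡⟨ cong (_+_ W) (∑-cong n (λ {i} _ → induction i)) ⟩
    W + ∑ n (λ i → + suc k * (a (suc i) * firstPartWeighted (n ∸ suc i) k))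
      ≡⟨ cong (_+_ W) (*-distribˡ-∑ n (+ suc k) _) ⟨
    W + + suc k * ∑ n (λ i → a (suc i) * firstPartWeighted (n ∸ suc i) k)
      ≡⟨ cong (λ t → W + + suc k * t) (∑-prepend-firstPartWeighted n k) ⟩
    W + + suc k * W
      ≡⟨ collect (+ suc k) W ⟩
    + suc (suc k) * W
      ∎
    where
    W = firstPartWeighted n (suc k)
    commute : ∀ u x f → u * (x * f) ≡ x * (u * f)
    commute = solve-∀
    collect : ∀ x f → f + x * f ≡ (+ 1 + x) * f
    collect = solve-∀
    induction : ∀ i → a (suc i) * (+ (n ∸ suc i) * innerSum a (n ∸ suc i) (suc k)) ≡
                      + suc k * (a (suc i) * firstPartWeighted (n ∸ suc i) k)
    induction i = trans (cong (a (suc i) *_) (n*innerSum≡k*firstPartWeighted k (n ∸ suc i)))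
                        (commute (a (suc i)) (+ suc k) _)

∣-cancel-prime : ∀ {p k z w} → Prime p → suc k < p → + p * z ≡ + suc k * w → + suc k ∣ z
∣-cancel-prime {p} {k} {z} {w} p-prime k<p pz≡kw =
  ∣ᵤ⇒∣ (coprime-divisor (+ suc k) (+ p) z (coprime-sym (prime⇒coprime p-prime k<p)) (∣⇒∣ᵤ k∣pz))
  where
  k∣pz : + suc k ∣ + p * z
  k∣pz = divides w (trans pz≡kw (ℤ.*-comm (+ suc k) w))

IsInteger : ℚ → Set
IsInteger q = ∃ λ (z : ℤ) → q ≡ z / 1

∣⇒IsInteger : ∀ {k z} → + suc k ∣ z → IsInteger (z / suc k)
∣⇒IsInteger {k} (divides q refl) =
  q , ℚ.fromℚᵘ-cong {mkℚᵘ (q * + suc k) k} {mkℚᵘ q 0} (*≡* (ℤ.*-identityʳ _))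

/1-homo-+ : ∀ x y → x / 1 ℚ.+ y / 1 ≡ (x + y) / 1
/1-homo-+ x y = ℚ.toℚᵘ-injective (ℚᵘ.≃-trans (ℚ.toℚᵘ-homo-+ (x / 1) (y / 1))
  (ℚᵘ.≃-trans (ℚᵘ.+-cong (ℚ.toℚᵘ-fromℚᵘ (mkℚᵘ x 0)) (ℚ.toℚᵘ-fromℚᵘ (mkℚᵘ y 0)))
  (ℚᵘ.≃-trans (*≡* (unit-denominators x y)) (ℚᵘ.≃-sym (ℚ.toℚᵘ-fromℚᵘ (mkℚᵘ (x + y) 0))))))
  where
  unit-denominators : ∀ x y → (x * + 1 + y * + 1) * + 1 ≡ (x + y) * (+ 1 * + 1)
  unit-denominators = solve-∀

IsInteger-sum : ∀ {A : Set} (f : A → ℚ) {xs} → All (λ x → IsInteger (f x)) xs →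
  IsInteger (foldr ℚ._+_ ℚ.0ℚ (map f xs))
IsInteger-sum f []                = + 0 , refl
IsInteger-sum f ((z , fx≡z) ∷ fxs) with IsInteger-sum f fxs
... | (w , sum≡w) = z + w , trans (cong₂ ℚ._+_ fx≡z sum≡w) (/1-homo-+ z w)

innerSum/k-isInteger : ∀ {p} → Prime p → (a : ℕ → ℤ) → ∀ {k} → suc k < p →
  IsInteger (innerSum a p (suc k) / suc k)
innerSum/k-isInteger {p} p-prime a {k} k<p =
  ∣⇒IsInteger (∣-cancel-prime p-prime k<p (n*innerSum≡k*firstPartWeighted a k p))

m<n∸1⇒1+m<n : ∀ {m} n → m < n ∸ 1 → suc m < n
m<n∸1⇒1+m<n (suc n) m<n = s≤s m<n

corollary3 : (n : ℕ) → Prime n → (a : ℕ → ℤ) →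
    ∃ λ (z : ℤ) → corollarySum a n ≡ z / 1
corollary3 n n-prime a = IsInteger-sum (λ k → innerSum a n (suc k) / suc k)
  (applyUpTo⁺₁ (λ k → k) (n ∸ 1) (λ k<n∸1 → innerSum/k-isInteger n-prime a (m<n∸1⇒1+m<n n k<n∸1)))
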